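{- Let $p<q<r$ be primes and $N>1$ an integer whose divisors $1=d_1<d_2<\cdots$ satisfy $d_2=p$, $d_3=q$, $d_4=p^2$, $d_5=r$, all in $S'_N$. Suppose $N$ is small recurrent with $U(p,q,a,b)$ for integers $a,b$. Then: (i) $\gcd(a,b)=1$; (ii) for every $i\ge1$: if $d_{2i}\in S'_N$ then $p\mid d_{2i}$, and if $d_{2i-1}\in S'_N$ then $p\nmid d_{2i-1}$; (iii) for all $d_i\in S'_N$ we have $\gcd(b,d_i)=1$, and for all $d_{2i-1}\in S'_N$ we have $\gcd(a,d_{2i-1})=1$; (iv) for $d_i,d_{i+1}\in S'_N$, $\gcd(d_i,d_{i+1})=1$; (v) for $d_{2i-1},d_{2i+1}\in S'_N$, $\gcd(d_{2i-1},d_{2i+1})=1$.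
   Context: For $N>1$ let $1=d_1<d_2<\cdots<d_{\tau(N)}=N$ be its divisors and $S'_N=\{d:1<d<\sqrt N,\ d\mid N\}=\{d_2,d_3,\ldots\}$. "$N$ is small recurrent with $U(p,q,a,b)$" means $d_2=p$, $d_3=q$ and $d_i=ad_{i-1}+bd_{i-2}$ for every $i\ge4$ with $d_i\in S'_N$. -}

module Defs where

open import Data.Nat using (ℕ; zero; suc; _*_; _<_; _∸_; _≥_)
open import Data.Nat.Divisibility using (_∣_; _∣?_)
open import Data.List using (List; []; _∷_; filter; applyUpTo)
open import Data.Integer as ℤ using (ℤ; +_)
open import Data.Product using (_×_)
open import Relation.Binary.PropositionalEquality using (_≡_)

divisors : ℕ → List ℕ
divisors N = filter (λ k → k ∣? N) (applyUpTo suc N)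

nth0 : List ℕ → ℕ → ℕ
nth0 []       _       = 0
nth0 (x ∷ xs) zero    = x
nth0 (x ∷ xs) (suc i) = nth0 xs i

-- d N i = d_i, the i-th divisor of N (1-based: d N 1 = 1);
-- d N 0 = 0 and d N i = 0 for i > τ(N) (junk values, never in S'_N).
d : ℕ → ℕ → ℕ
d N zero    = 0
d N (suc i) = nth0 (divisors N) i

-- x ∈ S'_N  :⇔  x ∣ N, 1 < x and x < √N (i.e. x * x < N).
InS' : ℕ → ℕ → Set
InS' N x = (x ∣ N) × (1 < x) × (x * x < N)

SmallRecurrent : ℕ → ℕ → ℕ → ℤ → ℤ → Set
SmallRecurrent N p q a b =
  (d N 2 ≡ p) × (d N 3 ≡ q) ×
  (∀ i → i ≥ 4 → InS' N (d N i) →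
     + d N i ≡ (a ℤ.* + d N (i ∸ 1)) ℤ.+ (b ℤ.* + d N (i ∸ 2)))

-- At d₄ = p² and d₅ = r the recurrence reads p² = a q + b p and r = a p² + b q.  The first
-- gives p ∣ a; then primality of r rules out p ∣ b, q ∣ a and any common factor of a and b,
-- and the first equation rules out q ∣ b.  Everything else is an induction along
-- d_{i+2} = a d_{i+1} + b d_i: as p ∣ a and p ∤ b, p divides d_{i+2} iff it divides d_i, which
-- is the parity pattern; and a common divisor g in any of the coprimality claims divides one
-- summand of the recurrence, hence the other, and a coprimality fact already established
-- (g against a or against b) moves it down to a smaller index.

module Submission where

open import Defs
open import Data.Nat using (ℕ; _<_; _≥_; _*_; _∸_; _+_; _≤_; zero; suc; z≤n; s≤s; z<s)
open import Data.Nat.Properties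
  using (<-irrefl; <-trans; <⇒≤; <⇒≢; ≤-<-trans; <-≤-trans; *-mono-≤; ≤-refl; ≤-trans; n≤1+n;
         +-comm; *-suc)
open import Data.Nat.Divisibility using (_∣_; _∣?_; ∣-trans; m∣m*n; 1∣_)
open import Data.Nat.Primality using (Prime; ¬prime[1]; prime⇒irreducible; euclidsLemma)
open import Data.Nat.Coprimality using (Coprime; coprime⇒gcd≡1)
import Data.Nat.Coprimality as Coprime
open import Data.Integer using (ℤ; +_; ∣_∣) renaming (_*_ to _*ᶻ_; _+_ to _+ᶻ_)
open import Data.Integer.GCD using (gcd)
import Data.Integer.Properties as ℤ
open import Data.Integer.Divisibility.Signed
  using (∣ᵤ⇒∣; ∣⇒∣ᵤ; ∣-refl; ∣m∣n⇒∣m+n; ∣m+n∣m⇒∣n; ∣m+n∣n⇒∣m; ∣n⇒∣m*n; ∣m⇒∣m*n)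
  renaming (_∣_ to _∣ᶻ_)
open import Data.Integer.Coprimality using (coprime-divisor)
open import Data.List using (_∷_; applyUpTo)
open import Data.List.Properties using (filter-accept)
open import Data.List.Relation.Unary.All using (All; _∷_; zip)
open import Data.List.Relation.Unary.AllPairs using (AllPairs; _∷_)
import Data.List.Relation.Unary.All.Properties as All
import Data.List.Relation.Unary.AllPairs.Properties as AllPairs
open import Data.Product using (_×_; _,_; proj₁; proj₂)
open import Data.Sum using (inj₁; inj₂)
open import Data.Empty using (⊥-elim)
open import Function using (_∘_)
open import Relation.Nullary using (¬_)
open import Relation.Binary.PropositionalEquality
  using (_≡_; refl; sym; trans; cong; cong₂; subst; subst₂; module ≡-Reasoning)

-- nth0 is 0 past the end of a list, so a positive entry at j + 1 shows that j is in range.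
nth0-pred : ∀ {P : ℕ → Set} xs j → AllPairs _<_ xs → All P xs →
            0 < nth0 xs (suc j) → nth0 xs j < nth0 xs (suc j) × P (nth0 xs j)
nth0-pred (x ∷ y ∷ ys) zero    ((x<y ∷ _) ∷ _) (px ∷ _) _   = x<y , px
nth0-pred (x ∷ y ∷ ys) (suc j) (_ ∷ sorted)    (_ ∷ ps) pos = nth0-pred (y ∷ ys) j sorted ps pos

divisors-sorted : ∀ N → AllPairs _<_ (divisors N)
divisors-sorted N = AllPairs.filter⁺ (_∣? N) (AllPairs.applyUpTo⁺₁ suc N (λ i<j _ → s≤s i<j))

divisors-positive-∣ : ∀ N → All (λ k → 0 < k × k ∣ N) (divisors N)
divisors-positive-∣ N = zip
  ( All.filter⁺ (_∣? N) (All.applyUpTo⁺₂ suc N (λ _ → z<s))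
  , All.all-filter (_∣? N) (applyUpTo suc N) )

d[1]≤1 : ∀ N → d N 1 ≤ 1
d[1]≤1 zero    = z≤n
d[1]≤1 (suc M) rewrite filter-accept (_∣? suc M) {xs = applyUpTo (suc ∘ suc) M} (1∣ suc M) = ≤-refl

¬InS'-d₁ : ∀ N → ¬ InS' N (d N 1)
¬InS'-d₁ N (_ , 1<d₁ , _) = <-irrefl refl (<-≤-trans 1<d₁ (d[1]≤1 N))

InS'-pred : ∀ N i → 2 ≤ i → InS' N (d N (suc i)) → InS' N (d N i)
InS'-pred N 1 (s≤s ()) _
InS'-pred N (suc (suc j)) _ (_ , 1<dᵢ₊₁ , dᵢ₊₁²<N) =
  let dᵢ<dᵢ₊₁ , 0<dᵢ , dᵢ∣N = nth0-pred (divisors N) (suc j) (divisors-sorted N) (divisors-positive-∣ N)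
                                          (<⇒≤ 1<dᵢ₊₁)
      dᵢ₋₁<dᵢ , 0<dᵢ₋₁ , _  = nth0-pred (divisors N) j (divisors-sorted N) (divisors-positive-∣ N) 0<dᵢ
  in dᵢ∣N , ≤-<-trans 0<dᵢ₋₁ dᵢ₋₁<dᵢ , ≤-<-trans (*-mono-≤ (<⇒≤ dᵢ<dᵢ₊₁) (<⇒≤ dᵢ<dᵢ₊₁)) dᵢ₊₁²<N

prime∣prime⇒≡ : ∀ {ℓ m} → Prime ℓ → Prime m → ℓ ∣ m → ℓ ≡ m
prime∣prime⇒≡ ℓ-prime m-prime ℓ∣m with prime⇒irreducible m-prime ℓ∣m
... | inj₁ refl = ⊥-elim (¬prime[1] ℓ-prime)
... | inj₂ ℓ≡m  = ℓ≡m

prime∣prime²⇒≡ : ∀ {ℓ m} → Prime ℓ → Prime m → ℓ ∣ m * m → ℓ ≡ m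
prime∣prime²⇒≡ {m = m} ℓ-prime m-prime ℓ∣m² with euclidsLemma m m ℓ-prime ℓ∣m²
... | inj₁ ℓ∣m = prime∣prime⇒≡ ℓ-prime m-prime ℓ∣m
... | inj₂ ℓ∣m = prime∣prime⇒≡ ℓ-prime m-prime ℓ∣m

prime∤⇒coprime : ∀ {ℓ m} → Prime ℓ → ¬ ℓ ∣ m → Coprime ℓ m
prime∤⇒coprime ℓ-prime ℓ∤m (k∣ℓ , k∣m) with prime⇒irreducible ℓ-prime k∣ℓ
... | inj₁ k≡1  = k≡1
... | inj₂ refl = ⊥-elim (ℓ∤m k∣m)

divisor-coprime : ∀ {k m n} → Coprime m n → k ∣ n → Coprime k m
divisor-coprime m⊥n k∣n (i∣k , i∣m) = m⊥n (i∣m , ∣-trans i∣k k∣n)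

coprime-∣-cancelˡ : ∀ {g z w} u x → Coprime g ∣ u ∣ → z ≡ u *ᶻ x +ᶻ w →
                    + g ∣ᶻ z → + g ∣ᶻ w → + g ∣ᶻ x
coprime-∣-cancelˡ {g} u x g⊥u z≡ux+w g∣z g∣w =
  ∣ᵤ⇒∣ (coprime-divisor (+ g) u x g⊥u
         (∣⇒∣ᵤ {i = u *ᶻ x} (∣m+n∣n⇒∣m (subst (+ g ∣ᶻ_) z≡ux+w g∣z) g∣w)))

coprime-∣-cancelʳ : ∀ {g z w} v y → Coprime g ∣ v ∣ → z ≡ w +ᶻ v *ᶻ y →
                    + g ∣ᶻ z → + g ∣ᶻ w → + g ∣ᶻ y
coprime-∣-cancelʳ {g} v y g⊥v z≡w+vy g∣z g∣w =
  ∣ᵤ⇒∣ (coprime-divisor (+ g) v y g⊥v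
         (∣⇒∣ᵤ {i = v *ᶻ y} (∣m+n∣m⇒∣n (subst (+ g ∣ᶻ_) z≡w+vy g∣z) g∣w)))

module SmallRecurrence
  {p q r N : ℕ} {a b : ℤ}
  (p-prime : Prime p) (q-prime : Prime q) (r-prime : Prime r) (p<q : p < q) (q<r : q < r)
  (d₄≡p² : d N 4 ≡ p * p) (d₅≡r : d N 5 ≡ r) (S₄ : InS' N (d N 4)) (S₅ : InS' N (d N 5))
  (small-recurrent : SmallRecurrent N p q a b)
  where

  open ≡-Reasoning

  S : ℕ → Set
  S i = InS' N (d N i)

  D : ℕ → ℤ
  D i = + d N i

  d₂≡p : d N 2 ≡ p
  d₂≡p = proj₁ small-recurrent

  d₃≡q : d N 3 ≡ q
  d₃≡q = proj₁ (proj₂ small-recurrent)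

  recurrence : ∀ i → 2 ≤ i → S (2 + i) → D (2 + i) ≡ a *ᶻ D (1 + i) +ᶻ b *ᶻ D i
  recurrence i 2≤i = proj₂ (proj₂ small-recurrent) (2 + i) (s≤s (s≤s 2≤i))

  S-pred₂ : ∀ i → 2 ≤ i → S (2 + i) → S i
  S-pred₂ i 2≤i = InS'-pred N i 2≤i ∘ InS'-pred N (suc i) (≤-trans 2≤i (n≤1+n i))

  p²≡aq+bp : + (p * p) ≡ a *ᶻ + q +ᶻ b *ᶻ + p
  p²≡aq+bp = begin
    + (p * p)                ≡⟨ cong +_ d₄≡p² ⟨
    D 4                      ≡⟨ recurrence 2 ≤-refl S₄ ⟩
    a *ᶻ D 3 +ᶻ b *ᶻ D 2     ≡⟨ cong₂ (λ x y → a *ᶻ + x +ᶻ b *ᶻ + y) d₃≡q d₂≡p ⟩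
    a *ᶻ + q +ᶻ b *ᶻ + p     ∎

  r≡ap²+bq : + r ≡ a *ᶻ + (p * p) +ᶻ b *ᶻ + q
  r≡ap²+bq = begin
    + r                      ≡⟨ cong +_ d₅≡r ⟨
    D 5                      ≡⟨ recurrence 3 (s≤s (s≤s z≤n)) S₅ ⟩
    a *ᶻ D 4 +ᶻ b *ᶻ D 3     ≡⟨ cong₂ (λ x y → a *ᶻ + x +ᶻ b *ᶻ + y) d₄≡p² d₃≡q ⟩
    a *ᶻ + (p * p) +ᶻ b *ᶻ + q ∎

  ∣p² : ∀ {g} → + g ∣ᶻ a *ᶻ + q → + g ∣ᶻ b *ᶻ + p → g ∣ p * p
  ∣p² {g} g∣aq g∣bp = ∣⇒∣ᵤ (subst (+ g ∣ᶻ_) (sym p²≡aq+bp) (∣m∣n⇒∣m+n g∣aq g∣bp))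

  ∣r : ∀ {g} → + g ∣ᶻ a *ᶻ + (p * p) → + g ∣ᶻ b *ᶻ + q → g ∣ r
  ∣r {g} g∣ap² g∣bq = ∣⇒∣ᵤ (subst (+ g ∣ᶻ_) (sym r≡ap²+bq) (∣m∣n⇒∣m+n g∣ap² g∣bq))

  p<r : p < r
  p<r = <-trans p<q q<r

  p∤q : ¬ p ∣ q
  p∤q = <⇒≢ p<q ∘ prime∣prime⇒≡ p-prime q-prime

  p⊥q : Coprime p q
  p⊥q = prime∤⇒coprime p-prime p∤q

  p∣a : + p ∣ᶻ a
  p∣a = coprime-∣-cancelˡ (+ q) a p⊥q (trans p²≡aq+bp (cong (_+ᶻ b *ᶻ + p) (ℤ.*-comm a (+ q))))
                          (∣ᵤ⇒∣ (m∣m*n p)) (∣n⇒∣m*n b ∣-refl)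

  p∤b : ¬ + p ∣ᶻ b
  p∤b p∣b = <⇒≢ p<r (prime∣prime⇒≡ p-prime r-prime (∣r (∣m⇒∣m*n _ p∣a) (∣m⇒∣m*n _ p∣b)))

  q∤a : ¬ + q ∣ᶻ a
  q∤a q∣a = <⇒≢ q<r (prime∣prime⇒≡ q-prime r-prime (∣r (∣m⇒∣m*n _ q∣a) (∣n⇒∣m*n b ∣-refl)))

  q∤b : ¬ + q ∣ᶻ b
  q∤b q∣b = <⇒≢ p<q (sym (prime∣prime²⇒≡ q-prime p-prime (∣p² (∣n⇒∣m*n a ∣-refl) (∣m⇒∣m*n _ q∣b))))

  a⊥b : Coprime ∣ a ∣ ∣ b ∣
  a⊥b {g} (g∣a , g∣b) = common-divisor≡1 (∣ᵤ⇒∣ g∣a) (∣ᵤ⇒∣ g∣b)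
    where
    common-divisor≡1 : + g ∣ᶻ a → + g ∣ᶻ b → g ≡ 1
    common-divisor≡1 g∣a g∣b with prime⇒irreducible r-prime (∣r (∣m⇒∣m*n _ g∣a) (∣m⇒∣m*n _ g∣b))
    ... | inj₁ g≡1  = g≡1
    ... | inj₂ refl = ⊥-elim (<⇒≢ p<r (sym (prime∣prime²⇒≡ r-prime p-prime
                        (∣p² (∣m⇒∣m*n _ g∣a) (∣m⇒∣m*n _ g∣b)))))

  p⊥b : Coprime p ∣ b ∣
  p⊥b = prime∤⇒coprime p-prime (p∤b ∘ ∣ᵤ⇒∣)

  ∣-recurrenceˡ : ∀ {g} i → 2 ≤ i → S (2 + i) → Coprime g ∣ a ∣ →
                  + g ∣ᶻ D (2 + i) → + g ∣ᶻ b *ᶻ D i → + g ∣ᶻ D (1 + i)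
  ∣-recurrenceˡ i 2≤i s g⊥a = coprime-∣-cancelˡ a (D (1 + i)) g⊥a (recurrence i 2≤i s)

  ∣-recurrenceʳ : ∀ {g} i → 2 ≤ i → S (2 + i) → Coprime g ∣ b ∣ →
                  + g ∣ᶻ D (2 + i) → + g ∣ᶻ a *ᶻ D (1 + i) → + g ∣ᶻ D i
  ∣-recurrenceʳ i 2≤i s g⊥b = coprime-∣-cancelʳ b (D i) g⊥b (recurrence i 2≤i s)

  p∣d-step : ∀ i → 2 ≤ i → S (2 + i) → + p ∣ᶻ D i → + p ∣ᶻ D (2 + i)
  p∣d-step i 2≤i s p∣dᵢ =
    subst (+ p ∣ᶻ_) (sym (recurrence i 2≤i s)) (∣m∣n⇒∣m+n (∣m⇒∣m*n _ p∣a) (∣n⇒∣m*n b p∣dᵢ))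

  p∤d-step : ∀ i → 2 ≤ i → S (2 + i) → ¬ + p ∣ᶻ D i → ¬ + p ∣ᶻ D (2 + i)
  p∤d-step i 2≤i s p∤dᵢ p∣dᵢ₊₂ = p∤dᵢ (∣-recurrenceʳ i 2≤i s p⊥b p∣dᵢ₊₂ (∣m⇒∣m*n _ p∣a))

  p∣d-even : ∀ n → S (2 + 2 * n) → + p ∣ᶻ D (2 + 2 * n)
  p∣d-even zero    _ = subst (λ x → + p ∣ᶻ + x) (sym d₂≡p) ∣-refl
  p∣d-even (suc n) = subst (λ i → S i → + p ∣ᶻ D i) (cong (λ k → 2 + k) (sym (*-suc 2 n))) λ s →
    p∣d-step (2 + 2 * n) (s≤s (s≤s z≤n)) s (p∣d-even n (S-pred₂ (2 + 2 * n) (s≤s (s≤s z≤n)) s))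

  p∤d-odd : ∀ n → S (1 + 2 * n) → ¬ + p ∣ᶻ D (1 + 2 * n)
  p∤d-odd zero          s = ⊥-elim (¬InS'-d₁ N s)
  p∤d-odd (suc zero)    _ = p∤q ∘ subst (p ∣_) d₃≡q ∘ ∣⇒∣ᵤ
  p∤d-odd (suc (suc n)) =
    subst (λ i → S i → ¬ + p ∣ᶻ D i) (cong (λ k → 1 + k) (sym (*-suc 2 (suc n)))) λ s →
      p∤d-step (1 + 2 * suc n) (s≤s (s≤s z≤n)) s
               (p∤d-odd (suc n) (S-pred₂ (1 + 2 * suc n) (s≤s (s≤s z≤n)) s))

  b⊥dᵢ : ∀ i → S i → Coprime ∣ b ∣ (d N i)
  b⊥dᵢ 0 (_ , () , _)
  b⊥dᵢ 1 s = ⊥-elim (¬InS'-d₁ N s)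
  b⊥dᵢ 2 _ = subst (Coprime ∣ b ∣) (sym d₂≡p) (Coprime.sym p⊥b)
  b⊥dᵢ 3 _ = subst (Coprime ∣ b ∣) (sym d₃≡q) (Coprime.sym (prime∤⇒coprime q-prime (q∤b ∘ ∣ᵤ⇒∣)))
  b⊥dᵢ (suc (suc (suc (suc k)))) s (g∣b , g∣dᵢ) =
    b⊥dᵢ (suc (suc (suc k))) (InS'-pred N (3 + k) (s≤s (s≤s z≤n)) s)
      (g∣b , ∣⇒∣ᵤ (∣-recurrenceˡ (2 + k) (s≤s (s≤s z≤n)) s (divisor-coprime a⊥b g∣b)
                                 (∣ᵤ⇒∣ g∣dᵢ) (∣m⇒∣m*n _ (∣ᵤ⇒∣ {i = b} g∣b))))

  dᵢ⊥dᵢ₊₁ : ∀ i → S i → S (suc i) → Coprime (d N i) (d N (suc i))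
  dᵢ⊥dᵢ₊₁ 0 (_ , () , _)
  dᵢ⊥dᵢ₊₁ 1 s = ⊥-elim (¬InS'-d₁ N s)
  dᵢ⊥dᵢ₊₁ 2 _ _ = subst₂ Coprime (sym d₂≡p) (sym d₃≡q) p⊥q
  dᵢ⊥dᵢ₊₁ (suc (suc (suc k))) s s' (g∣dᵢ , g∣dᵢ₊₁) =
    dᵢ⊥dᵢ₊₁ (suc (suc k)) (InS'-pred N (2 + k) (s≤s (s≤s z≤n)) s) s
      (∣⇒∣ᵤ (∣-recurrenceʳ (2 + k) (s≤s (s≤s z≤n)) s' (divisor-coprime (b⊥dᵢ (3 + k) s) g∣dᵢ)
                           (∣ᵤ⇒∣ g∣dᵢ₊₁) (∣n⇒∣m*n a (∣ᵤ⇒∣ g∣dᵢ)))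
      , g∣dᵢ)

  a⊥dᵢ : ∀ i → S i → ¬ + p ∣ᶻ D i → Coprime ∣ a ∣ (d N i)
  a⊥dᵢ 0 (_ , () , _)
  a⊥dᵢ 1 s = ⊥-elim (¬InS'-d₁ N s)
  a⊥dᵢ 2 s p∤d₂ = ⊥-elim (p∤d₂ (p∣d-even 0 s))
  a⊥dᵢ 3 _ _ = subst (Coprime ∣ a ∣) (sym d₃≡q) (Coprime.sym (prime∤⇒coprime q-prime (q∤a ∘ ∣ᵤ⇒∣)))
  a⊥dᵢ (suc (suc (suc (suc k)))) s p∤dᵢ (g∣a , g∣dᵢ) =
    a⊥dᵢ (suc (suc k)) (S-pred₂ (2 + k) (s≤s (s≤s z≤n)) s)
         (p∤dᵢ ∘ p∣d-step (2 + k) (s≤s (s≤s z≤n)) s)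
      (g∣a , ∣⇒∣ᵤ (∣-recurrenceʳ (2 + k) (s≤s (s≤s z≤n)) s (divisor-coprime (Coprime.sym a⊥b) g∣a)
                                 (∣ᵤ⇒∣ g∣dᵢ) (∣m⇒∣m*n _ (∣ᵤ⇒∣ {i = a} g∣a))))

  dᵢ⊥dᵢ₊₂ : ∀ i → S i → S (2 + i) → ¬ + p ∣ᶻ D i → Coprime (d N i) (d N (2 + i))
  dᵢ⊥dᵢ₊₂ 0 (_ , () , _)
  dᵢ⊥dᵢ₊₂ 1 s = ⊥-elim (¬InS'-d₁ N s)
  dᵢ⊥dᵢ₊₂ i@(suc (suc k)) s s' p∤dᵢ (g∣dᵢ , g∣dᵢ₊₂) =
    dᵢ⊥dᵢ₊₁ i s (InS'-pred N (suc i) (s≤s (s≤s z≤n)) s')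
      (g∣dᵢ , ∣⇒∣ᵤ (∣-recurrenceˡ i (s≤s (s≤s z≤n)) s' (divisor-coprime (a⊥dᵢ i s p∤dᵢ) g∣dᵢ)
                                  (∣ᵤ⇒∣ g∣dᵢ₊₂) (∣n⇒∣m*n b (∣ᵤ⇒∣ g∣dᵢ))))

  parity : ∀ i → i ≥ 1 → (S (2 * i) → p ∣ d N (2 * i)) × (S (2 * i ∸ 1) → ¬ p ∣ d N (2 * i ∸ 1))
  parity (suc n) _ =
      subst (λ j → S j → p ∣ d N j) (sym (*-suc 2 n)) (∣⇒∣ᵤ ∘ p∣d-even n)
    , subst (λ j → S j → ¬ p ∣ d N j) (sym (cong (_∸ 1) (*-suc 2 n))) (λ s → p∤d-odd n s ∘ ∣ᵤ⇒∣)

  p∤d[2i-1] : ∀ i → i ≥ 1 → S (2 * i ∸ 1) → ¬ + p ∣ᶻ D (2 * i ∸ 1)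
  p∤d[2i-1] i i≥1 s = proj₂ (parity i i≥1) s ∘ ∣⇒∣ᵤ

  d[i]⊥d[i+1] : ∀ i → S i → S (i + 1) → Coprime (d N i) (d N (i + 1))
  d[i]⊥d[i+1] i s = subst (λ j → S j → Coprime (d N i) (d N j)) (+-comm 1 i) (dᵢ⊥dᵢ₊₁ i s)

  d[2i-1]⊥d[2i+1] : ∀ i → i ≥ 1 → S (2 * i ∸ 1) → S (2 * i + 1) →
                    Coprime (d N (2 * i ∸ 1)) (d N (2 * i + 1))
  d[2i-1]⊥d[2i+1] i@(suc _) i≥1 s =
    subst (λ j → S j → Coprime (d N (2 * i ∸ 1)) (d N j)) (+-comm 1 (2 * i))
          (λ s′ → dᵢ⊥dᵢ₊₂ (2 * i ∸ 1) s s′ (p∤d[2i-1] i i≥1 s))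

lemma2p3 : (p q r N : ℕ) (a b : ℤ) →
    Prime p → Prime q → Prime r → p < q → q < r → 1 < N →
    d N 2 ≡ p → d N 3 ≡ q → d N 4 ≡ p * p → d N 5 ≡ r →
    InS' N (d N 2) → InS' N (d N 3) → InS' N (d N 4) → InS' N (d N 5) →
    SmallRecurrent N p q a b →
    (gcd a b ≡ + 1)
    × (∀ i → i ≥ 1 →
         (InS' N (d N (2 * i)) → p ∣ d N (2 * i))
         × (InS' N (d N (2 * i ∸ 1)) → ¬ (p ∣ d N (2 * i ∸ 1))))
    × (∀ i → InS' N (d N i) → gcd b (+ d N i) ≡ + 1)
    × (∀ i → i ≥ 1 → InS' N (d N (2 * i ∸ 1)) → gcd a (+ d N (2 * i ∸ 1)) ≡ + 1)
    × (∀ i → InS' N (d N i) → InS' N (d N (i + 1)) →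
         gcd (+ d N i) (+ d N (i + 1)) ≡ + 1)
    × (∀ i → i ≥ 1 → InS' N (d N (2 * i ∸ 1)) → InS' N (d N (2 * i + 1)) →
         gcd (+ d N (2 * i ∸ 1)) (+ d N (2 * i + 1)) ≡ + 1)
lemma2p3 p q r N a b p-prime q-prime r-prime p<q q<r _ _ _ d₄≡p² d₅≡r _ _ S₄ S₅ small-recurrent =
    cong +_ (coprime⇒gcd≡1 a⊥b)
  , parity
  , (λ i s → cong +_ (coprime⇒gcd≡1 (b⊥dᵢ i s)))
  , (λ i i≥1 s → cong +_ (coprime⇒gcd≡1 (a⊥dᵢ (2 * i ∸ 1) s (p∤d[2i-1] i i≥1 s))))
  , (λ i s → cong +_ ∘ coprime⇒gcd≡1 ∘ d[i]⊥d[i+1] i s)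
  , (λ i i≥1 s → cong +_ ∘ coprime⇒gcd≡1 ∘ d[2i-1]⊥d[2i+1] i i≥1 s)
  where
  open SmallRecurrence {a = a} {b = b} p-prime q-prime r-prime p<q q<r d₄≡p² d₅≡r S₄ S₅ small-recurrent
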